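{- Consider an instance of Fault-Tolerant $\ell$-Flow Augmentation on a directed graph $D=(V,A)$ with terminals $s,t$, vulnerable arcs $M\subseteq A$, and an arc set $X_0\subseteq A$ that is the union of $\ell$ arc-disjoint $s$-$t$ paths. Let $Y\subseteq A\setminus X_0$. Then $Y$ is a feasible solution (i.e. for every $f\in M$, $(X_0\cup Y)\setminus\{f\}$ contains $\ell$ arc-disjoint $s$-$t$ paths) if and only if for each vulnerable arc $f=uv\in M\cap X_0$, the vertices $u$ and $v$ lie in the same strongly connected component of the residual graph $D_{X_0}(X_0\cup Y)$.
   Context: For $Y\subseteq A\setminus X_0$, the residual graph $D_{X_0}(X_0\cup Y)$ is the directed graph on $V$ whose arc set consists of all arcs of $Y$ (in their original direction) together with the reversal $vu$ of every arc $uv\in X_0$. -}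

module Defs where

open import Data.Nat using (ℕ)
open import Data.Fin using (Fin)
open import Data.Fin.Subset using (Subset; _∈_; _∉_; _∪_; _-_)
open import Data.List using (List; []; _∷_; map)
open import Data.List.Relation.Unary.All using (All)
open import Data.List.Relation.Unary.Unique.Propositional using (Unique)
import Data.List.Membership.Propositional as LM
open import Data.Vec using (Vec; lookup)
open import Data.Product using (Σ; ∃; ∃-syntax; _×_)
open import Data.Sum using (_⊎_)
open import Relation.Binary.PropositionalEquality using (_≡_)
open import Relation.Nullary using (¬_)
open import Relation.Binary.Construct.Closure.ReflexiveTransitive using (Star)

-- A directed multigraph D = (V, A) with V = Fin n, A = Fin m;
-- arc a goes from (tl a) to (hd a).
record Digraph : Set where
  field
    n  : ℕ
    m  : ℕ
    tl : Fin m → Fin n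
    hd : Fin m → Fin n

module _ (D : Digraph) where
  open Digraph D

  Vertex = Fin n
  Arc    = Fin m
  ArcSet = Subset m

  data IsWalk : Vertex → Vertex → List Arc → Set where
    nil  : ∀ {u} → IsWalk u u []
    cons : ∀ {u w a as} → tl a ≡ u → IsWalk (hd a) w as → IsWalk u w (a ∷ as)

  IsPath : Vertex → Vertex → List Arc → Set
  IsPath s t as = IsWalk s t as × Unique (s ∷ map hd as)

  ArcDisjoint : List Arc → List Arc → Set
  ArcDisjoint p q = ∀ a → a LM.∈ p → ¬ (a LM.∈ q)

  DisjointPaths : (ℓ : ℕ) → Vertex → Vertex → Vec (List Arc) ℓ → Set
  DisjointPaths ℓ s t ps =
    (∀ i → IsPath s t (lookup ps i)) ×
    (∀ i j → ¬ (i ≡ j) → ArcDisjoint (lookup ps i) (lookup ps j))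

  ContainsPaths : (ℓ : ℕ) → Vertex → Vertex → ArcSet → Set
  ContainsPaths ℓ s t X =
    ∃[ ps ] (DisjointPaths ℓ s t ps × (∀ i → All (_∈ X) (lookup ps i)))

  IsUnionOfPaths : (ℓ : ℕ) → Vertex → Vertex → ArcSet → Set
  IsUnionOfPaths ℓ s t X =
    ∃[ ps ] (DisjointPaths ℓ s t ps ×
             (∀ a → (a ∈ X → ∃[ i ] (a LM.∈ lookup ps i)) ×
                    (∃[ i ] (a LM.∈ lookup ps i) → a ∈ X)))

  Feasible : (ℓ : ℕ) → Vertex → Vertex → (M X0 Y : ArcSet) → Set
  Feasible ℓ s t M X0 Y = ∀ f → f ∈ M → ContainsPaths ℓ s t ((X0 ∪ Y) - f)

  -- arcs of the residual graph D_{X0}(X0 ∪ Y): arcs of Y in original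
  -- direction, plus the reversal vu of every arc uv ∈ X0
  ResidualArc : (X0 Y : ArcSet) → Vertex → Vertex → Set
  ResidualArc X0 Y u v = ∃[ a ] ((a ∈ Y × tl a ≡ u × hd a ≡ v) ⊎
                                 (a ∈ X0 × hd a ≡ u × tl a ≡ v))

  ResReach : (X0 Y : ArcSet) → Vertex → Vertex → Set
  ResReach X0 Y = Star (ResidualArc X0 Y)

  SameSCC : (X0 Y : ArcSet) → Vertex → Vertex → Set
  SameSCC X0 Y u v = ResReach X0 Y u v × ResReach X0 Y v u

-- Arc sets are treated as ℕ-weights on arcs, compared through their net flow across vertex sets R,
-- an additive ℤ-valued functional. A 0/1 weight whose net flow across every R is ℓ ([s ∈ R] − [t ∈ R])
-- splits into ℓ arc-disjoint s-t paths, peeled off one at a time. If f ∈ X0 and the residual graph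
-- has a path from tl f to hd f, pushing one unit around the cycle it forms with the reversal of f
-- turns X0 into such a weight avoiding f. If it has none, the residual-reachable set R of tl f is
-- entered by no arc of X0 and left by no arc of Y, but left by f; so every flow inside (X0 ∪ Y) ∖ f
-- has smaller net flow across R than X0, although both have value ℓ.

module Submission where

open import Defs

open import Data.Nat as ℕ using (ℕ; zero; suc; z≤n; s≤s)
import Data.Nat.Properties as ℕ
open import Data.Integer as ℤ using (ℤ; +_; 0ℤ; 1ℤ; _+_; _*_; _≤_)
import Data.Integer.Properties as ℤ
open import Data.Integer.Tactic.RingSolver using (solve-∀)
open import Data.Fin using (Fin; zero; suc; _≟_)
open import Data.Fin.Properties using (any?; suc-injective)
open import Data.Fin.Subset using (Subset; _∈_; _∉_; _∪_; _─_; _-_; ⁅_⁆; ∣_∣)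
open import Data.Fin.Subset.Properties
  using ( _∈?_; ∣p∣≤n; p⊂q⇒∣p∣<∣q∣; p⊆p∪q; p─q⊆p; x∈p∪q⁺; x∈p∪q⁻; x∈⁅x⁆; x∈⁅y⁆⇒x≡y
        ; x∈p∧x≢y⇒x∈p-y)
open import Data.List using (List; []; _∷_; map)
open import Data.Vec using (Vec; []; _∷_; lookup)
import Data.Vec.Base as Vec
open import Data.List.Relation.Unary.Any using (here; there)
open import Data.List.Relation.Unary.All as All using (All; []; _∷_)
open import Data.List.Relation.Unary.All.Properties using (¬Any⇒All¬)
open import Data.List.Relation.Unary.AllPairs using ([]; _∷_)
open import Data.List.Relation.Unary.Unique.Propositional using (Unique)
import Data.List.Relation.Unary.Unique.Propositional.Properties as Unique
import Data.List.Membership.Propositional as List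
import Data.List.Membership.DecPropositional as DecList
open import Data.Product using (∃-syntax; ∃₂; _×_; _,_; proj₁; proj₂)
open import Data.Sum using (_⊎_; inj₁; inj₂)
open import Data.Empty using (⊥; ⊥-elim)
open import Function using (_∘_; flip)
open import Function.Bundles using (_⇔_; mk⇔)
open import Level using (Level; 0ℓ)
open import Relation.Binary using (Rel; Decidable)
open import Relation.Binary.Construct.Closure.ReflexiveTransitive using (Star; ε; _◅_; _◅◅_)
open import Relation.Binary.PropositionalEquality
  using (_≡_; _≢_; refl; sym; trans; cong; cong₂; subst; module ≡-Reasoning)
open import Relation.Nullary using (Dec; yes; no; contradiction)
open import Relation.Nullary.Decidable using (_×-dec_; _⊎-dec_; ¬?)

open import Algebra.Properties.AbelianGroup ℤ.+-0-abelianGroup using (∙-cancelˡ; ∙-cancelʳ)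
open import Algebra.Properties.CommutativeSemigroup ℤ.+-commutativeSemigroup
  using (x∙yz≈y∙xz; x∙yz≈yx∙z)
open import Algebra.Properties.CommutativeMonoid.Sum ℤ.+-0-commutativeMonoid
  using (sum; sum-cong-≗; ∑-distrib-+; sum-replicate-zero)

private variable
  k n : ℕ
  ℓ : Level

∑-mono-≤ : {f g : Fin k → ℤ} → (∀ i → f i ≤ g i) → sum f ≤ sum g
∑-mono-≤ {zero}  f≤g = ℤ.≤-refl
∑-mono-≤ {suc k} f≤g = ℤ.+-mono-≤ (f≤g zero) (∑-mono-≤ (f≤g ∘ suc))

∑-concentrated : (f : Fin k → ℤ) (j : Fin k) → (∀ i → i ≢ j → f i ≡ 0ℤ) → sum f ≡ f j
∑-concentrated {suc k} f zero    f≡0 = trans (cong (λ r → f zero + r) rest≡0) (ℤ.+-identityʳ (f zero))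
  where
  rest≡0 : sum (f ∘ suc) ≡ 0ℤ
  rest≡0 = trans (sum-cong-≗ (λ i → f≡0 (suc i) λ ())) (sum-replicate-zero k)
∑-concentrated {suc k} f (suc j) f≡0 =
  trans (cong (_+ sum (f ∘ suc)) (f≡0 zero λ ()))
        (trans (ℤ.+-identityˡ _)
               (∑-concentrated (f ∘ suc) j (λ i i≢j → f≡0 (suc i) (i≢j ∘ suc-injective))))

+≤1 : ∀ {x y} → x ℕ.≤ 1 → y ℕ.≤ 1 → (1 ℕ.≤ x → 1 ℕ.≤ y → ⊥) → x ℕ.+ y ℕ.≤ 1
+≤1 {zero}          _        y≤1 _    = y≤1
+≤1 {suc zero} {zero}  _     _   _    = s≤s z≤n
+≤1 {suc zero} {suc _} _     _   both = contradiction (s≤s z≤n) (both (s≤s z≤n))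
+≤1 {suc (suc _)}   (s≤s ()) _   _

≤1⇒≤ : ∀ {x y} → x ℕ.≤ 1 → (1 ℕ.≤ x → 1 ℕ.≤ y) → x ℕ.≤ y
≤1⇒≤ {zero}        _        _     = z≤n
≤1⇒≤ {suc zero}    _        pos⇒pos = pos⇒pos (s≤s z≤n)
≤1⇒≤ {suc (suc _)} (s≤s ()) _

1≤+⇒1≤⊎1≤ : ∀ x {y} → 1 ℕ.≤ x ℕ.+ y → 1 ℕ.≤ x ⊎ 1 ℕ.≤ y
1≤+⇒1≤⊎1≤ zero    1≤y = inj₂ 1≤y
1≤+⇒1≤⊎1≤ (suc _) _   = inj₁ (s≤s z≤n)

x∈p─q⇒x∉q : ∀ {x : Fin n} (p q : Subset n) → x ∈ p ─ q → x ∉ q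
x∈p─q⇒x∉q (_ ∷ p) (_ ∷ q) (Vec.there x∈p─q) (Vec.there x∈q) = x∈p─q⇒x∉q p q x∈p─q x∈q

x∈p-y⇒x≢y : ∀ {x y : Fin n} (p : Subset n) → x ∈ p - y → x ≢ y
x∈p-y⇒x≢y {x = x} p x∈p-x refl = x∈p─q⇒x∉q p ⁅ x ⁆ x∈p-x (x∈⁅x⁆ x)

x∉p⇒∣p∣<∣p∪⁅x⁆∣ : ∀ {p : Subset n} {x} → x ∉ p → ∣ p ∣ ℕ.< ∣ p ∪ ⁅ x ⁆ ∣
x∉p⇒∣p∣<∣p∪⁅x⁆∣ {x = x} x∉p = p⊂q⇒∣p∣<∣q∣ (p⊆p∪q ⁅ x ⁆ , x , x∈p∪q⁺ (inj₂ (x∈⁅x⁆ x)) , x∉p)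

-- Cuts

χ : {P : Set ℓ} → Dec P → ℤ
χ (yes _) = 1ℤ
χ (no _)  = 0ℤ

-- +1 if a step from x to y leaves R, -1 if it enters R.
crossing : Subset n → Fin n → Fin n → ℤ
crossing R x y = χ (x ∈? R) ℤ.- χ (y ∈? R)

crossing-trans : ∀ (R : Subset n) x y z → crossing R x y + crossing R y z ≡ crossing R x z
crossing-trans R x y z = telescope (χ (x ∈? R)) (χ (y ∈? R)) (χ (z ∈? R))
  where
  telescope : ∀ a b c → (a ℤ.- b) + (b ℤ.- c) ≡ a ℤ.- c
  telescope = solve-∀

crossing-refl : ∀ (R : Subset n) x → crossing R x x ≡ 0ℤ
crossing-refl R x = ℤ.+-inverseʳ (χ (x ∈? R))

crossing-leaving : ∀ {R : Subset n} {x y} → x ∈ R → y ∉ R → crossing R x y ≡ 1ℤ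
crossing-leaving {R = R} {x} {y} x∈R y∉R with x ∈? R | y ∈? R
... | yes _ | no _    = refl
... | no x∉R | _      = contradiction x∈R x∉R
... | yes _ | yes y∈R = contradiction y∈R y∉R

*-crossing-mono : ∀ {R : Subset n} {u v} {x y : ℕ} →
                  (u ∈ R → v ∉ R → x ℕ.≤ y) → (u ∉ R → v ∈ R → y ℕ.≤ x) →
                  + x * crossing R u v ≤ + y * crossing R u v
*-crossing-mono {R = R} {u} {v} {x} {y} leaving entering with u ∈? R | v ∈? R
... | yes _   | yes _   = ℤ.≤-reflexive (trans (ℤ.*-zeroʳ (+ x)) (sym (ℤ.*-zeroʳ (+ y))))
... | no _    | no _    = ℤ.≤-reflexive (trans (ℤ.*-zeroʳ (+ x)) (sym (ℤ.*-zeroʳ (+ y))))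
... | yes u∈R | no v∉R
  rewrite ℤ.*-identityʳ (+ x) | ℤ.*-identityʳ (+ y) = ℤ.+≤+ (leaving u∈R v∉R)
... | no u∉R  | yes v∈R
  rewrite ℤ.*-comm (+ x) ℤ.-1ℤ | ℤ.*-comm (+ y) ℤ.-1ℤ | ℤ.-1*i≡-i (+ x) | ℤ.-1*i≡-i (+ y)
  = ℤ.neg-mono-≤ (ℤ.+≤+ (entering u∉R v∈R))

-- Reachability

Closed : Rel (Fin n) ℓ → Subset n → Set ℓ
Closed T R = ∀ {w w′} → w ∈ R → T w w′ → w′ ∈ R

module _ {T : Rel (Fin n) ℓ} (T? : Decidable T) where

  private
    Reached : Fin n → Subset n → Set ℓ
    Reached x R = ∀ {w} → w ∈ R → Star T x w

    exit? : ∀ R → Dec (∃₂ λ w w′ → w ∈ R × w′ ∉ R × T w w′)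
    exit? R = any? λ w → any? λ w′ → (w ∈? R) ×-dec (¬? (w′ ∈? R) ×-dec T? w w′)

    reached-∪-⁅⁆ : ∀ {x R w w′} → Reached x R → w ∈ R → T w w′ → Reached x (R ∪ ⁅ w′ ⁆)
    reached-∪-⁅⁆ {R = R} {w′ = w′} reached w∈R t v∈R′ with x∈p∪q⁻ R ⁅ w′ ⁆ v∈R′
    ... | inj₁ v∈R = reached v∈R
    ... | inj₂ v∈w′ rewrite x∈⁅y⁆⇒x≡y w′ v∈w′ = reached w∈R ◅◅ (t ◅ ε)

    -- The fuel k bounds the number of vertices still missing from R.
    grow : ∀ k {x} R → n ℕ.≤ k ℕ.+ ∣ R ∣ → x ∈ R → Reached x R →
           ∃[ R′ ] (x ∈ R′ × Reached x R′ × Closed T R′)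
    grow k R bound x∈R reached with exit? R
    ... | no no-exit = R , x∈R , reached , closed
      where
      closed : Closed T R
      closed {w} {w′} w∈R t with w′ ∈? R
      ... | yes w′∈R = w′∈R
      ... | no w′∉R  = contradiction (w , w′ , w∈R , w′∉R , t) no-exit
    grow zero    R bound x∈R reached | yes (_ , w′ , _ , w′∉R , _) =
      contradiction (ℕ.≤-trans (∣p∣≤n (R ∪ ⁅ w′ ⁆)) bound)
                    (ℕ.<⇒≱ (x∉p⇒∣p∣<∣p∪⁅x⁆∣ w′∉R))
    grow (suc k) R bound x∈R reached | yes (w , w′ , w∈R , w′∉R , t) =
      grow k (R ∪ ⁅ w′ ⁆) bound′ (p⊆p∪q ⁅ w′ ⁆ x∈R) (reached-∪-⁅⁆ reached w∈R t)
      where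
      bound′ : n ℕ.≤ k ℕ.+ ∣ R ∪ ⁅ w′ ⁆ ∣
      bound′ = ℕ.≤-trans bound (ℕ.≤-trans (ℕ.≤-reflexive (sym (ℕ.+-suc k ∣ R ∣)))
                                          (ℕ.+-monoʳ-≤ k (x∉p⇒∣p∣<∣p∪⁅x⁆∣ w′∉R)))

  reach-or-separate : ∀ x y → Star T x y ⊎ ∃[ R ] (x ∈ R × y ∉ R × Closed T R)
  reach-or-separate x y with grow n ⁅ x ⁆ (ℕ.m≤m+n n _) (x∈⁅x⁆ x) reached-⁅⁆
    where
    reached-⁅⁆ : Reached x ⁅ x ⁆
    reached-⁅⁆ w∈x rewrite x∈⁅y⁆⇒x≡y x w∈x = ε
  ... | R , x∈R , reached , closed with y ∈? R
  ...   | yes y∈R = inj₁ (reached y∈R)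
  ...   | no y∉R  = inj₂ (R , x∈R , y∉R , closed)

module _ {T : Rel (Fin n) ℓ} where
  open DecList (_≟_ {n}) using () renaming (_∈?_ to _∈ₗ?_)

  vertices : ∀ {x y} → Star T x y → List (Fin n)
  vertices {x} ε       = x ∷ []
  vertices {x} (_ ◅ r) = x ∷ vertices r

  end∈vertices : ∀ {x y} (r : Star T x y) → y List.∈ vertices r
  end∈vertices ε       = here refl
  end∈vertices (_ ◅ r) = there (end∈vertices r)

  Simple : ∀ {x y} → Star T x y → Set
  Simple r = Unique (vertices r)

  private
    suffix : ∀ {x y} (r : Star T x y) → Simple r →
             ∀ {z} → z List.∈ vertices r → ∃[ r′ ] Simple {z} {y} r′
    suffix ε       simple       (here refl) = ε , simple
    suffix (t ◅ r) simple       (here refl) = t ◅ r , simple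
    suffix (_ ◅ r) (_ ∷ simple) (there z∈r) = suffix r simple z∈r

  shortcut : ∀ {x y} → Star T x y → ∃[ r′ ] Simple {x} {y} r′
  shortcut ε = ε , [] ∷ []
  shortcut {x} (t ◅ r) with shortcut r
  ... | r′ , simple with x ∈ₗ? vertices r′
  ...   | yes x∈r′ = suffix r′ simple x∈r′
  ...   | no x∉r′  = t ◅ r′ , ¬Any⇒All¬ _ x∉r′ ∷ simple

-- Arc weights and flows

module _ (D : Digraph) where
  open Digraph D using (tl; hd)

  Weight : Set
  Weight = Arc D → ℕ

  _⊕_ : Weight → Weight → Weight
  (g ⊕ h) a = g a ℕ.+ h a

  δ : Arc D → Weight
  δ b a with a ≟ b
  ... | yes _ = 1
  ... | no _  = 0

  δ-diag : ∀ b → δ b b ≡ 1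
  δ-diag b with b ≟ b
  ... | yes _   = refl
  ... | no b≢b  = contradiction refl b≢b

  δ-off : ∀ {a b} → a ≢ b → δ b a ≡ 0
  δ-off {a} {b} a≢b with a ≟ b
  ... | yes a≡b = contradiction a≡b a≢b
  ... | no _    = refl

  occurrences : List (Arc D) → Weight
  occurrences []      a = 0
  occurrences (b ∷ p) a = δ b a ℕ.+ occurrences p a

  load : Vec (List (Arc D)) k → Weight
  load []       a = 0
  load (p ∷ ps) a = occurrences p a ℕ.+ load ps a

  Cut : Set
  Cut = Subset (Digraph.n D)

  net : Cut → Weight → ℤ
  net R g = sum λ a → + g a * crossing R (tl a) (hd a)

  -- Conservation and value c, stated for every cut instead of every vertex.
  IsFlow : Vertex D → Vertex D → ℕ → Weight → Set
  IsFlow x y c g = ∀ R → net R g ≡ + c * crossing R x y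

  net-cong : ∀ (R : Cut) {g h} → (∀ a → g a ≡ h a) → net R g ≡ net R h
  net-cong R g≡h = sum-cong-≗ λ a → cong (λ w → + w * crossing R (tl a) (hd a)) (g≡h a)

  net-⊕ : ∀ (R : Cut) g h → net R (g ⊕ h) ≡ net R g + net R h
  net-⊕ R g h = trans (sum-cong-≗ λ a → ℤ.*-distribʳ-+ (crossing R (tl a) (hd a)) (+ g a) (+ h a))
                      (∑-distrib-+ (λ a → + g a * crossing R (tl a) (hd a))
                                   (λ a → + h a * crossing R (tl a) (hd a)))

  net-zero : ∀ (R : Cut) → net R (λ _ → 0) ≡ 0ℤ
  net-zero R = sum-replicate-zero (Digraph.m D)

  net-δ : ∀ (R : Cut) b → net R (δ b) ≡ crossing R (tl b) (hd b)
  net-δ R b = trans (∑-concentrated _ b off)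
                    (trans (cong (λ w → + w * crossing R (tl b) (hd b)) (δ-diag b)) (ℤ.*-identityˡ _))
    where
    off : ∀ a → a ≢ b → + δ b a * crossing R (tl a) (hd a) ≡ 0ℤ
    off a a≢b rewrite δ-off a≢b = refl

  net-walk : ∀ (R : Cut) {x y p} → IsWalk D x y p → net R (occurrences p) ≡ crossing R x y
  net-walk R {x} nil = trans (net-zero R) (sym (crossing-refl R x))
  net-walk R {y = y} {b ∷ p} (cons refl walk) = begin
    net R (δ b ⊕ occurrences p)                     ≡⟨ net-⊕ R (δ b) (occurrences p) ⟩
    net R (δ b) + net R (occurrences p)             ≡⟨ cong₂ _+_ (net-δ R b) (net-walk R walk) ⟩
    crossing R (tl b) (hd b) + crossing R (hd b) y  ≡⟨ crossing-trans R (tl b) (hd b) y ⟩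
    crossing R (tl b) y                             ∎
    where open ≡-Reasoning

  load-isFlow : ∀ {x y} (ps : Vec (List (Arc D)) k) → (∀ i → IsWalk D x y (lookup ps i)) →
                IsFlow x y k (load ps)
  load-isFlow []       walks R = net-zero R
  load-isFlow {k = suc k} {x} {y} (p ∷ ps) walks R = begin
    net R (occurrences p ⊕ load ps)                ≡⟨ net-⊕ R (occurrences p) (load ps) ⟩
    net R (occurrences p) + net R (load ps)        ≡⟨ cong₂ _+_ (net-walk R (walks zero))
                                                               (load-isFlow ps (walks ∘ suc) R) ⟩
    crossing R x y + + k * crossing R x y          ≡⟨ ℤ.suc-* (+ k) (crossing R x y) ⟨
    + suc k * crossing R x y                       ∎
    where open ≡-Reasoning

  δ≤1 : ∀ b a → δ b a ℕ.≤ 1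
  δ≤1 b a with a ≟ b
  ... | yes _ = s≤s z≤n
  ... | no _  = z≤n

  δ-support : ∀ {a b} → 1 ℕ.≤ δ b a → a ≡ b
  δ-support {a} {b} pos with a ≟ b
  ... | yes a≡b = a≡b

  occurrences-∈ : ∀ p {a} → 1 ℕ.≤ occurrences p a → a List.∈ p
  occurrences-∈ (b ∷ p) {a} pos with 1≤+⇒1≤⊎1≤ (δ b a) pos
  ... | inj₁ δ-pos   = here (δ-support δ-pos)
  ... | inj₂ occ-pos = there (occurrences-∈ p occ-pos)

  ∈-occurrences : ∀ {p a} → a List.∈ p → 1 ℕ.≤ occurrences p a
  ∈-occurrences {b ∷ p} (here refl) rewrite δ-diag b = s≤s z≤n
  ∈-occurrences {b ∷ p} (there a∈p) = ℕ.≤-trans (∈-occurrences a∈p) (ℕ.m≤n+m _ (δ b _))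

  occurrences-unique : ∀ {p} → Unique p → ∀ a → occurrences p a ℕ.≤ 1
  occurrences-unique {[]}    _              a = z≤n
  occurrences-unique {b ∷ p} (b∉p ∷ unique) a =
    +≤1 (δ≤1 b a) (occurrences-unique unique a)
        (λ δ-pos occ-pos → All.lookup b∉p (occurrences-∈ p occ-pos) (sym (δ-support δ-pos)))

  path-unique : ∀ {x y p} → IsPath D x y p → Unique p
  path-unique (_ , _ ∷ heads-unique) = Unique.map⁻ heads-unique

  load-∈ : ∀ (ps : Vec (List (Arc D)) k) {a} → 1 ℕ.≤ load ps a → ∃[ i ] a List.∈ lookup ps i
  load-∈ (p ∷ ps) {a} pos with 1≤+⇒1≤⊎1≤ (occurrences p a) pos
  ... | inj₁ occ-pos  = zero , occurrences-∈ p occ-pos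
  ... | inj₂ load-pos with load-∈ ps load-pos
  ...   | i , a∈ps[i] = suc i , a∈ps[i]

  ∈-load : ∀ (ps : Vec (List (Arc D)) k) {a} i → a List.∈ lookup ps i → 1 ℕ.≤ load ps a
  ∈-load (p ∷ ps)     zero    a∈p     = ℕ.≤-trans (∈-occurrences a∈p) (ℕ.m≤m+n _ _)
  ∈-load (p ∷ ps) {a} (suc i) a∈ps[i] = ℕ.≤-trans (∈-load ps i a∈ps[i]) (ℕ.m≤n+m _ (occurrences p a))

  module _ {x y : Vertex D} {p : List (Arc D)} {ps : Vec (List (Arc D)) k} where

    disjointPaths-∷⁻ : DisjointPaths D (suc k) x y (p ∷ ps) →
                       IsPath D x y p × DisjointPaths D k x y ps × (∀ i → ArcDisjoint D p (lookup ps i))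
    disjointPaths-∷⁻ (paths , disjoint) =
      paths zero , (paths ∘ suc , λ i j i≢j → disjoint (suc i) (suc j) (i≢j ∘ suc-injective)) ,
      λ i → disjoint zero (suc i) λ ()

    disjointPaths-∷⁺ : IsPath D x y p → DisjointPaths D k x y ps →
                       (∀ i → ArcDisjoint D p (lookup ps i)) → DisjointPaths D (suc k) x y (p ∷ ps)
    disjointPaths-∷⁺ path (paths , disjoint) p-disjoint = paths′ , disjoint′
      where
      paths′ : ∀ i → IsPath D x y (lookup (p ∷ ps) i)
      paths′ zero    = path
      paths′ (suc i) = paths i
      disjoint′ : ∀ i j → i ≢ j → ArcDisjoint D (lookup (p ∷ ps) i) (lookup (p ∷ ps) j)
      disjoint′ zero    zero    0≢0 = contradiction refl 0≢0
      disjoint′ zero    (suc j) _   = p-disjoint j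
      disjoint′ (suc i) zero    _   = λ a a∈ps[i] a∈p → p-disjoint i a a∈p a∈ps[i]
      disjoint′ (suc i) (suc j) i≢j = disjoint i j (i≢j ∘ cong suc)

  load-≤1 : ∀ {x y} (ps : Vec (List (Arc D)) k) → DisjointPaths D k x y ps → ∀ a → load ps a ℕ.≤ 1
  load-≤1 []       _     a = z≤n
  load-≤1 (p ∷ ps) paths a with disjointPaths-∷⁻ paths
  ... | path , rest , p-disjoint =
    +≤1 (occurrences-unique (path-unique path) a) (load-≤1 ps rest a)
        λ occ-pos load-pos → let i , a∈ps[i] = load-∈ ps load-pos in
                             p-disjoint i a (occurrences-∈ p occ-pos) a∈ps[i]

  InSupport : Weight → List (Arc D) → Set
  InSupport g = All λ a → 1 ℕ.≤ g a

  Support : Weight → Rel (Vertex D) 0ℓ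
  Support g x y = ∃[ a ] (1 ℕ.≤ g a × tl a ≡ x × hd a ≡ y)

  support? : ∀ g → Decidable (Support g)
  support? g x y = any? λ a → (1 ℕ.≤? g a) ×-dec ((tl a ≟ x) ×-dec (hd a ≟ y))

  private
    arcs : ∀ {g x y} → Star (Support g) x y → List (Arc D)
    arcs ε             = []
    arcs ((a , _) ◅ r) = a ∷ arcs r

    arcs-walk : ∀ {g x y} (r : Star (Support g) x y) → IsWalk D x y (arcs r)
    arcs-walk ε                             = nil
    arcs-walk ((a , _ , refl , refl) ◅ r) = cons refl (arcs-walk r)

    arcs-support : ∀ {g x y} (r : Star (Support g) x y) → InSupport g (arcs r)
    arcs-support ε                   = []
    arcs-support ((_ , pos , _) ◅ r) = pos ∷ arcs-support r

    vertices-arcs : ∀ {g x y} (r : Star (Support g) x y) → vertices r ≡ x ∷ map hd (arcs r)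
    vertices-arcs ε                             = refl
    vertices-arcs ((a , _ , refl , refl) ◅ r) = cong (tl a ∷_) (vertices-arcs r)

  support-path : ∀ {g x y} → Star (Support g) x y → ∃[ p ] (IsPath D x y p × InSupport g p)
  support-path r with shortcut r
  ... | r′ , simple = arcs r′ , (arcs-walk r′ , subst Unique (vertices-arcs r′) simple) , arcs-support r′

  -- If t is unreachable in the support, the support-closed set around s has nonpositive net
  -- outflow, although the flow value is positive.
  flow-path : ∀ {s t c g} → IsFlow s t (suc c) g → ∃[ p ] (IsPath D s t p × InSupport g p)
  flow-path {s} {t} {c} {g} flow with reach-or-separate (support? g) s t
  ... | inj₁ r = support-path r
  ... | inj₂ (R , s∈R , t∉R , closed) = contradiction positive (ℤ.<⇒≱ (ℤ.+<+ (s≤s z≤n)))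
    where
    unleft : ∀ a → tl a ∈ R → hd a ∉ R → g a ℕ.≤ 0
    unleft a tl∈R hd∉R = ℕ.≮⇒≥ λ pos → hd∉R (closed tl∈R (a , pos , refl , refl))
    positive : + suc c ≤ 0ℤ
    positive = begin
      + suc c                    ≡⟨ ℤ.*-identityʳ (+ suc c) ⟨
      + suc c * 1ℤ               ≡⟨ cong (λ w → + suc c * w) (crossing-leaving s∈R t∉R) ⟨
      + suc c * crossing R s t   ≡⟨ flow R ⟨
      net R g                    ≤⟨ ∑-mono-≤ (λ a → *-crossing-mono (unleft a) λ _ _ → z≤n) ⟩
      net R (λ _ → 0)            ≡⟨ net-zero R ⟩
      0ℤ                         ∎
      where open ℤ.≤-Reasoning

  flow-∸-walk : ∀ {s t c g g′ p} → (∀ a → g a ≡ g′ a ℕ.+ occurrences p a) → IsWalk D s t p →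
                IsFlow s t (suc c) g → IsFlow s t c g′
  flow-∸-walk {s} {t} {c} {g} {g′} {p} split walk flow R = ∙-cancelˡ (crossing R s t) _ _ (begin
    crossing R s t + net R g′                   ≡⟨ ℤ.+-comm (crossing R s t) (net R g′) ⟩
    net R g′ + crossing R s t                   ≡⟨ cong (λ w → net R g′ + w) (net-walk R walk) ⟨
    net R g′ + net R (occurrences p)            ≡⟨ net-⊕ R g′ (occurrences p) ⟨
    net R (g′ ⊕ occurrences p)                  ≡⟨ net-cong R split ⟨
    net R g                                     ≡⟨ flow R ⟩
    + suc c * crossing R s t                    ≡⟨ ℤ.suc-* (+ c) (crossing R s t) ⟩
    crossing R s t + + c * crossing R s t       ∎)
    where open ≡-Reasoning

  private
    module WithoutPath {g p} (g≤1 : ∀ a → g a ℕ.≤ 1) (p⊆g : InSupport g p) (unique : Unique p) where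

      rest : Weight
      rest a = g a ℕ.∸ occurrences p a

      split : ∀ a → g a ≡ rest a ℕ.+ occurrences p a
      split a = sym (ℕ.m∸n+n≡m (≤1⇒≤ (occurrences-unique unique a)
                                      λ pos → All.lookup p⊆g (occurrences-∈ p pos)))

      rest≤g : ∀ a → rest a ℕ.≤ g a
      rest≤g a = ℕ.m∸n≤m (g a) (occurrences p a)

      rest-avoids-p : ∀ {a} → a List.∈ p → 1 ℕ.≤ rest a → ⊥
      rest-avoids-p {a} a∈p pos = ℕ.<⇒≱ (s≤s (s≤s z≤n)) (begin
        2                                ≤⟨ ℕ.+-mono-≤ pos (∈-occurrences a∈p) ⟩
        rest a ℕ.+ occurrences p a       ≡⟨ split a ⟨
        g a                              ≤⟨ g≤1 a ⟩
        1                                ∎)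
        where open ℕ.≤-Reasoning

  decompose : ∀ {s t} c g → (∀ a → g a ℕ.≤ 1) → IsFlow s t c g →
              ∃[ ps ] (DisjointPaths D c s t ps × ∀ i → InSupport g (lookup ps i))
  decompose zero    g _   _    = [] , ((λ ()) , λ ()) , λ ()
  decompose (suc c) g g≤1 flow with flow-path {c = c} flow
  ... | p , path , p⊆g =
    let ps , paths , ps⊆rest = decompose c rest (λ a → ℕ.≤-trans (rest≤g a) (g≤1 a))
                                          (flow-∸-walk {c = c} split (proj₁ path) flow)
    in p ∷ ps , disjointPaths-∷⁺ path paths (p-disjoint {ps} ps⊆rest) , ⊆g {ps} ps⊆rest
    where
    open WithoutPath g≤1 p⊆g (path-unique path)
    p-disjoint : ∀ {ps : Vec _ c} → (∀ i → InSupport rest (lookup ps i)) →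
                 ∀ i → ArcDisjoint D p (lookup ps i)
    p-disjoint ps⊆rest i a a∈p a∈ps[i] = rest-avoids-p a∈p (All.lookup (ps⊆rest i) a∈ps[i])
    ⊆g : ∀ {ps : Vec _ c} → (∀ i → InSupport rest (lookup ps i)) →
         ∀ i → InSupport g (lookup (p ∷ ps) i)
    ⊆g ps⊆rest zero    = p⊆g
    ⊆g ps⊆rest (suc i) = All.map (λ {a} → flip ℕ.≤-trans (rest≤g a)) (ps⊆rest i)

  flow-exchange : ∀ {s t c g g′ h h′} → (∀ a → g a ℕ.+ h a ≡ g′ a ℕ.+ h′ a) →
                  (∀ R → net R h ≡ net R h′) → IsFlow s t c g′ → IsFlow s t c g
  flow-exchange {s} {t} {c} {g} {g′} {h} {h′} split same-net flow R = ∙-cancelʳ (net R h) _ _ (begin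
    net R g + net R h                ≡⟨ net-⊕ R g h ⟨
    net R (g ⊕ h)                    ≡⟨ net-cong R split ⟩
    net R (g′ ⊕ h′)                  ≡⟨ net-⊕ R g′ h′ ⟩
    net R g′ + net R h′              ≡⟨ cong₂ _+_ (flow R) (sym (same-net R)) ⟩
    + c * crossing R s t + net R h   ∎)
    where open ≡-Reasoning

  module UnionOfPaths {ℓ s t X0} (X0-paths : IsUnionOfPaths D ℓ s t X0) where

    private
      ps : Vec (List (Arc D)) ℓ
      ps = proj₁ X0-paths

      paths : DisjointPaths D ℓ s t ps
      paths = proj₁ (proj₂ X0-paths)

      X0⇒ps : ∀ {a} → a ∈ X0 → ∃[ i ] a List.∈ lookup ps i
      X0⇒ps {a} = proj₁ (proj₂ (proj₂ X0-paths) a)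

      ps⇒X0 : ∀ {a} → ∃[ i ] a List.∈ lookup ps i → a ∈ X0
      ps⇒X0 {a} = proj₂ (proj₂ (proj₂ X0-paths) a)

    base : Weight
    base = load ps

    base≤1 : ∀ a → base a ℕ.≤ 1
    base≤1 = load-≤1 ps paths

    base-flow : IsFlow s t ℓ base
    base-flow = load-isFlow ps (proj₁ ∘ proj₁ paths)

    base-support : ∀ {a} → 1 ℕ.≤ base a → a ∈ X0
    base-support = ps⇒X0 ∘ load-∈ ps

    ∈⇒base-pos : ∀ {a} → a ∈ X0 → 1 ℕ.≤ base a
    ∈⇒base-pos a∈X0 = let i , a∈ps[i] = X0⇒ps a∈X0 in ∈-load ps i a∈ps[i]

    unaffected : ∀ {Y f} → f ∉ X0 → ContainsPaths D ℓ s t ((X0 ∪ Y) - f)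
    unaffected f∉X0 = ps , paths , λ i → All.tabulate λ a∈ps[i] →
      let a∈X0 = ps⇒X0 (i , a∈ps[i]) in
      x∈p∧x≢y⇒x∈p-y (x∈p∪q⁺ (inj₁ a∈X0)) λ { refl → f∉X0 a∈X0 }

  -- The residual graph

  module _ (X0 Y : ArcSet D) where

    residual? : Decidable (ResidualArc D X0 Y)
    residual? x y = any? λ a → ((a ∈? Y) ×-dec ((tl a ≟ x) ×-dec (hd a ≟ y)))
                          ⊎-dec ((a ∈? X0) ×-dec ((hd a ≟ x) ×-dec (tl a ≟ y)))

    forwardArcs backwardArcs : ∀ {x y} → ResReach D X0 Y x y → List (Arc D)
    forwardArcs ε                  = []
    forwardArcs ((a , inj₁ _) ◅ r) = a ∷ forwardArcs r
    forwardArcs ((_ , inj₂ _) ◅ r) = forwardArcs r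
    backwardArcs ε                  = []
    backwardArcs ((_ , inj₁ _) ◅ r) = backwardArcs r
    backwardArcs ((a , inj₂ _) ◅ r) = a ∷ backwardArcs r

    net-residual : ∀ R {x y} (r : ResReach D X0 Y x y) →
                   net R (occurrences (forwardArcs r)) ≡
                   net R (occurrences (backwardArcs r)) + crossing R x y
    net-residual R {x} ε =
      sym (trans (cong (λ w → net R (λ _ → 0) + w) (crossing-refl R x)) (ℤ.+-identityʳ _))
    net-residual R {y = y} ((b , inj₁ (_ , refl , refl)) ◅ r) = begin
      net R (δ b ⊕ F)                     ≡⟨ net-⊕ R (δ b) F ⟩
      net R (δ b) + net R F               ≡⟨ cong₂ _+_ (net-δ R b) (net-residual R r) ⟩
      arc + (net R B + rest)              ≡⟨ x∙yz≈y∙xz arc (net R B) rest ⟩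
      net R B + (arc + rest)              ≡⟨ cong (λ w → net R B + w) (crossing-trans R (tl b) (hd b) y) ⟩
      net R B + crossing R (tl b) y       ∎
      where
      open ≡-Reasoning
      F B : Weight
      F = occurrences (forwardArcs r)
      B = occurrences (backwardArcs r)
      arc rest : ℤ
      arc  = crossing R (tl b) (hd b)
      rest = crossing R (hd b) y
    net-residual R {y = y} ((b , inj₂ (_ , refl , refl)) ◅ r) = begin
      net R F                             ≡⟨ net-residual R r ⟩
      net R B + crossing R (tl b) y       ≡⟨ cong (λ w → net R B + w) (crossing-trans R (tl b) (hd b) y) ⟨
      net R B + (arc + rest)              ≡⟨ x∙yz≈yx∙z (net R B) arc rest ⟩
      (arc + net R B) + rest              ≡⟨ cong (λ w → w + net R B + rest) (net-δ R b) ⟨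
      (net R (δ b) + net R B) + rest      ≡⟨ cong (_+ rest) (net-⊕ R (δ b) B) ⟨
      net R (δ b ⊕ B) + rest              ∎
      where
      open ≡-Reasoning
      F B : Weight
      F = occurrences (forwardArcs r)
      B = occurrences (backwardArcs r)
      arc rest : ℤ
      arc  = crossing R (tl b) (hd b)
      rest = crossing R (hd b) y

    forwardArcs⊆Y : ∀ {x y} (r : ResReach D X0 Y x y) → All (_∈ Y) (forwardArcs r)
    forwardArcs⊆Y ε                             = []
    forwardArcs⊆Y ((_ , inj₁ (a∈Y , _)) ◅ r) = a∈Y ∷ forwardArcs⊆Y r
    forwardArcs⊆Y ((_ , inj₂ _) ◅ r)          = forwardArcs⊆Y r

    backwardArcs⊆X0 : ∀ {x y} (r : ResReach D X0 Y x y) → All (_∈ X0) (backwardArcs r)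
    backwardArcs⊆X0 ε                              = []
    backwardArcs⊆X0 ((_ , inj₁ _) ◅ r)          = backwardArcs⊆X0 r
    backwardArcs⊆X0 ((_ , inj₂ (a∈X0 , _)) ◅ r) = a∈X0 ∷ backwardArcs⊆X0 r

    private
      forward-tails : ∀ {x y} (r : ResReach D X0 Y x y) →
                      All (λ a → tl a List.∈ vertices r) (forwardArcs r)
      forward-tails ε                                  = []
      forward-tails ((_ , inj₁ (_ , refl , _)) ◅ r) = here refl ∷ All.map there (forward-tails r)
      forward-tails ((_ , inj₂ _) ◅ r)               = All.map there (forward-tails r)

      backward-heads : ∀ {x y} (r : ResReach D X0 Y x y) →
                       All (λ a → hd a List.∈ vertices r) (backwardArcs r)
      backward-heads ε                                  = []
      backward-heads ((_ , inj₁ _) ◅ r)               = All.map there (backward-heads r)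
      backward-heads ((_ , inj₂ (_ , refl , _)) ◅ r) = here refl ∷ All.map there (backward-heads r)

    forwardArcs-unique : ∀ {x y} (r : ResReach D X0 Y x y) → Simple r → Unique (forwardArcs r)
    forwardArcs-unique ε _ = []
    forwardArcs-unique ((b , inj₁ (_ , refl , _)) ◅ r) (tl-b-fresh ∷ simple) =
      All.map (λ tl-a∈r b≡a → All.lookup tl-b-fresh tl-a∈r (cong tl b≡a)) (forward-tails r)
      ∷ forwardArcs-unique r simple
    forwardArcs-unique ((_ , inj₂ _) ◅ r) (_ ∷ simple) = forwardArcs-unique r simple

    backwardArcs-unique : ∀ {x y} (r : ResReach D X0 Y x y) → Simple r → Unique (backwardArcs r)
    backwardArcs-unique ε _ = []
    backwardArcs-unique ((_ , inj₁ _) ◅ r) (_ ∷ simple) = backwardArcs-unique r simple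
    backwardArcs-unique ((b , inj₂ (_ , refl , _)) ◅ r) (hd-b-fresh ∷ simple) =
      All.map (λ hd-a∈r b≡a → All.lookup hd-b-fresh hd-a∈r (cong hd b≡a)) (backward-heads r)
      ∷ backwardArcs-unique r simple

    backwardArcs-avoid-end : ∀ {x y} (r : ResReach D X0 Y x y) → Simple r →
                             All (λ a → hd a ≢ y) (backwardArcs r)
    backwardArcs-avoid-end ε _ = []
    backwardArcs-avoid-end ((_ , inj₁ _) ◅ r) (_ ∷ simple) = backwardArcs-avoid-end r simple
    backwardArcs-avoid-end ((_ , inj₂ (_ , refl , _)) ◅ r) (hd-b-fresh ∷ simple) =
      All.lookup hd-b-fresh (end∈vertices r) ∷ backwardArcs-avoid-end r simple

    module _ {ℓ s t} (X0-paths : IsUnionOfPaths D ℓ s t X0) where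
      open UnionOfPaths X0-paths

      private
        -- Push one unit of flow around the cycle formed by r and the reversal of f.
        module Rerouting (Y∩X0≡∅ : ∀ a → a ∈ Y → a ∉ X0) {f} (f∈X0 : f ∈ X0)
                         {r : ResReach D X0 Y (tl f) (hd f)} (simple : Simple r) where

          forward backward kept dropped rerouted : Weight
          forward  = occurrences (forwardArcs r)
          backward = occurrences (backwardArcs r)
          kept     = base ⊕ forward
          dropped  = backward ⊕ δ f
          rerouted a = kept a ℕ.∸ dropped a

          forward-support : ∀ {a} → 1 ℕ.≤ forward a → a ∈ Y
          forward-support pos = All.lookup (forwardArcs⊆Y r) (occurrences-∈ _ pos)

          backward-support : ∀ {a} → 1 ℕ.≤ backward a → a ∈ X0 × a ≢ f
          backward-support pos =
            let a∈r = occurrences-∈ _ pos in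
            All.lookup (backwardArcs⊆X0 r) a∈r , All.lookup (backwardArcs-avoid-end r simple) a∈r ∘ cong hd

          kept≤1 : ∀ a → kept a ℕ.≤ 1
          kept≤1 a = +≤1 (base≤1 a) (occurrences-unique (forwardArcs-unique r simple) a)
                         λ base-pos forward-pos →
                           Y∩X0≡∅ a (forward-support forward-pos) (base-support base-pos)

          dropped≤kept : ∀ a → dropped a ℕ.≤ kept a
          dropped≤kept a =
            ≤1⇒≤ dropped≤1 λ pos → ℕ.≤-trans (∈⇒base-pos (dropped-support pos)) (ℕ.m≤m+n _ _)
            where
            dropped≤1 : dropped a ℕ.≤ 1
            dropped≤1 = +≤1 (occurrences-unique (backwardArcs-unique r simple) a) (δ≤1 f a)
                            λ backward-pos δ-pos → proj₂ (backward-support backward-pos) (δ-support δ-pos)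
            dropped-support : 1 ℕ.≤ dropped a → a ∈ X0
            dropped-support pos with 1≤+⇒1≤⊎1≤ (backward a) pos
            ... | inj₁ backward-pos = proj₁ (backward-support backward-pos)
            ... | inj₂ δ-pos        = subst (_∈ X0) (sym (δ-support δ-pos)) f∈X0

          rerouted≤1 : ∀ a → rerouted a ℕ.≤ 1
          rerouted≤1 a = ℕ.≤-trans (ℕ.m∸n≤m (kept a) (dropped a)) (kept≤1 a)

          rerouted-flow : IsFlow s t ℓ rerouted
          rerouted-flow = flow-exchange {s} {t} {ℓ} {rerouted} {base} {dropped} {forward}
                            (λ a → ℕ.m∸n+n≡m (dropped≤kept a)) same-net base-flow
            where
            same-net : ∀ R → net R dropped ≡ net R forward
            same-net R = begin
              net R (backward ⊕ δ f)                      ≡⟨ net-⊕ R backward (δ f) ⟩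
              net R backward + net R (δ f)                ≡⟨ cong (λ w → net R backward + w) (net-δ R f) ⟩
              net R backward + crossing R (tl f) (hd f)   ≡⟨ net-residual R r ⟨
              net R forward                               ∎
              where open ≡-Reasoning

          rerouted-support : ∀ {a} → 1 ℕ.≤ rerouted a → a ∈ (X0 ∪ Y) - f
          rerouted-support {a} pos =
            x∈p∧x≢y⇒x∈p-y (x∈p∪q⁺ kept-support) λ { refl → ℕ.<⇒≱ pos f-dropped }
            where
            f-dropped : rerouted f ℕ.≤ 0
            f-dropped = ℕ.≤-reflexive (ℕ.m≤n⇒m∸n≡0 (ℕ.≤-trans (kept≤1 f)
                          (subst (λ w → 1 ℕ.≤ backward f ℕ.+ w) (sym (δ-diag f)) (ℕ.m≤n+m 1 _))))
            kept-support : a ∈ X0 ⊎ a ∈ Y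
            kept-support with 1≤+⇒1≤⊎1≤ (base a) (ℕ.≤-trans pos (ℕ.m∸n≤m (kept a) (dropped a)))
            ... | inj₁ base-pos    = inj₁ (base-support base-pos)
            ... | inj₂ forward-pos = inj₂ (forward-support forward-pos)

      reach⇒containsPaths : (∀ a → a ∈ Y → a ∉ X0) → ∀ {f} → f ∈ X0 →
                            ResReach D X0 Y (tl f) (hd f) → ContainsPaths D ℓ s t ((X0 ∪ Y) - f)
      reach⇒containsPaths Y∩X0≡∅ f∈X0 r with shortcut r
      ... | _ , simple =
        let ps , paths , ps⊆rerouted = decompose ℓ rerouted rerouted≤1 rerouted-flow
        in ps , paths , λ i → All.map rerouted-support (ps⊆rerouted i)
        where open Rerouting Y∩X0≡∅ f∈X0 simple

      private
        -- No arc of X0 enters the residual-closed set R and f leaves it, while the surviving paths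
        -- can leave R only along X0 ∖ f: so their net flow out of R is smaller than that of X0.
        module Blocked {f} (f∈X0 : f ∈ X0) {ps} (paths : DisjointPaths D ℓ s t ps)
                       (ps⊆ : ∀ i → All (_∈ (X0 ∪ Y) - f) (lookup ps i))
                       {R} (tl∈R : tl f ∈ R) (hd∉R : hd f ∉ R)
                       (closed : Closed (ResidualArc D X0 Y) R) where

          surviving : Weight
          surviving = load ps

          surviving-flow : IsFlow s t ℓ surviving
          surviving-flow = load-isFlow ps (proj₁ ∘ proj₁ paths)

          surviving-support : ∀ {a} → 1 ℕ.≤ surviving a → a ∈ (X0 ∪ Y) - f
          surviving-support pos = let i , a∈ps[i] = load-∈ ps pos in All.lookup (ps⊆ i) a∈ps[i]

          dominated : ∀ a → + (δ f a ℕ.+ surviving a) * crossing R (tl a) (hd a) ≤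
                            + base a * crossing R (tl a) (hd a)
          dominated a = *-crossing-mono leaving entering
            where
            leaving : tl a ∈ R → hd a ∉ R → δ f a ℕ.+ surviving a ℕ.≤ base a
            leaving tl∈R hd∉R =
              ≤1⇒≤ (+≤1 (δ≤1 f a) (load-≤1 ps paths a) both) (∈⇒base-pos ∘ support)
              where
              both : 1 ℕ.≤ δ f a → 1 ℕ.≤ surviving a → ⊥
              both δ-pos pos = x∈p-y⇒x≢y (X0 ∪ Y) (surviving-support pos) (δ-support δ-pos)
              support : 1 ℕ.≤ δ f a ℕ.+ surviving a → a ∈ X0
              support pos with 1≤+⇒1≤⊎1≤ (δ f a) pos
              ... | inj₁ δ-pos = subst (_∈ X0) (sym (δ-support δ-pos)) f∈X0
              ... | inj₂ surviving-pos
                with x∈p∪q⁻ X0 Y (p─q⊆p (X0 ∪ Y) ⁅ f ⁆ (surviving-support surviving-pos))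
              ...   | inj₁ a∈X0 = a∈X0
              ...   | inj₂ a∈Y  = contradiction (closed tl∈R (a , inj₁ (a∈Y , refl , refl))) hd∉R
            entering : tl a ∉ R → hd a ∈ R → base a ℕ.≤ δ f a ℕ.+ surviving a
            entering tl∉R hd∈R = ℕ.≤-trans (ℕ.≮⇒≥ λ pos →
                                   tl∉R (closed hd∈R (a , inj₂ (base-support pos , refl , refl)))) z≤n

          suc-net≤net : ℤ.suc (net R base) ≤ net R base
          suc-net≤net = begin
            1ℤ + net R base                              ≡⟨ cong₂ _+_ (crossing-leaving tl∈R hd∉R) same-net ⟨
            crossing R (tl f) (hd f) + net R surviving   ≡⟨ cong (_+ net R surviving) (net-δ R f) ⟨
            net R (δ f) + net R surviving                ≡⟨ net-⊕ R (δ f) surviving ⟨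
            net R (δ f ⊕ surviving)                      ≤⟨ ∑-mono-≤ dominated ⟩
            net R base                                   ∎
            where
            open ℤ.≤-Reasoning
            same-net : net R surviving ≡ net R base
            same-net = trans (surviving-flow R) (sym (base-flow R))

      containsPaths⇒reach : ∀ {f} → f ∈ X0 → ContainsPaths D ℓ s t ((X0 ∪ Y) - f) →
                            ResReach D X0 Y (tl f) (hd f)
      containsPaths⇒reach {f} f∈X0 (ps , paths , ps⊆) with reach-or-separate residual? (tl f) (hd f)
      ... | inj₁ r = r
      ... | inj₂ (R , tl∈R , hd∉R , closed) = ⊥-elim (ℤ.i≮i (ℤ.suc[i]≤j⇒i<j suc-net≤net))
        where open Blocked f∈X0 {ps} paths ps⊆ tl∈R hd∉R closed

lemma23 : (D : Digraph) (ℓ : ℕ) (s t : Vertex D) (M X0 Y : ArcSet D) →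
          IsUnionOfPaths D ℓ s t X0 →
          (∀ a → a ∈ Y → a ∉ X0) →
          Feasible D ℓ s t M X0 Y ⇔
            (∀ f → f ∈ M → f ∈ X0 →
               SameSCC D X0 Y (Digraph.tl D f) (Digraph.hd D f))
lemma23 D ℓ s t M X0 Y X0-paths Y∩X0≡∅ = mk⇔ feasible⇒sameSCC sameSCC⇒feasible
  where
  open Digraph D using (tl; hd)

  feasible⇒sameSCC : Feasible D ℓ s t M X0 Y → ∀ f → f ∈ M → f ∈ X0 → SameSCC D X0 Y (tl f) (hd f)
  feasible⇒sameSCC feasible f f∈M f∈X0 =
    containsPaths⇒reach D X0 Y X0-paths f∈X0 (feasible f f∈M) , (f , inj₂ (f∈X0 , refl , refl)) ◅ ε

  sameSCC⇒feasible : (∀ f → f ∈ M → f ∈ X0 → SameSCC D X0 Y (tl f) (hd f)) → Feasible D ℓ s t M X0 Y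
  sameSCC⇒feasible sameSCC f f∈M with f ∈? X0
  ... | yes f∈X0 = reach⇒containsPaths D X0 Y X0-paths Y∩X0≡∅ f∈X0 (proj₁ (sameSCC f f∈M f∈X0))
  ... | no f∉X0  = UnionOfPaths.unaffected D X0-paths f∉X0
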